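{- Let $D$ be an $n\times n$ distance matrix. If a temporal graph $\mathcal{G}=(G,\lambda)$ on $[n]$ is $\mathrm{Fo}$-compatible with $D$ and a temporal edge $(\{v,w\},\tau)$ (with $v\neq w\in[n]$, $\tau\in\mathbb{N}_{>0}$) is $\mathrm{Fo}$-edge-compatible with $D$, then the temporal graph $\mathcal{G}'$ obtained from $\mathcal{G}$ by adding the label $\tau$ to the edge $\{v,w\}$ (adding the edge if necessary) is also $\mathrm{Fo}$-compatible with $D$.
   Context: A temporal graph $\mathcal{G}=(G,\lambda)$ consists of a static undirected graph $G=(V,E)$ with $V=[n]$ and $\lambda:E\to 2^{\mathbb{N}_{>0}}$ giving the finite set of times each edge appears; $(\{v,w\},\tau)$ with $\tau\in\lambda(\{v,w\})$ is a temporal edge. A strict temporal $uv$-path is a path $u=v_0,\dots,v_k=v$ in $G$ with distinct vertices and times $\tau_1<\dots<\tau_k$, $\tau_i\in\lambda(\{v_{i-1},v_i\})$; arrival time $\tau_k$. $\mathrm{Fo}(\mathcal{G})$ is the $n\times n$ matrix with diagonal $0$ and entry $(u,v)$, $u\ne v$, the minimum arrival time of a strict temporal $uv$-path ($\infty$ if none). A distance matrix is an $n\times n$ matrix with entries in $\mathbb{N}\cup\{\infty\}$, zero exactly on the diagonal. A temporal edge $(\{v,w\},\tau)$ is $\mathrm{Fo}$-edge-compatible with $D$ if for all $x\in[n]$: $D_{xv}<\tau\Rightarrow D_{xw}\le\tau$ and $D_{xw}<\tau\Rightarrow D_{xv}\le\tau$. A temporal graph $\mathcal{G}$ is $\mathrm{Fo}$-compatible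 with $D$ if $D_{uv}\le \mathrm{Fo}(\mathcal{G})_{uv}$ for all $u,v\in[n]$ and every temporal edge of $\mathcal{G}$ is $\mathrm{Fo}$-edge-compatible with $D$. -}

module Defs where

open import Data.Nat using (ℕ; zero; suc; _≤_; _<_)
open import Data.Fin using (Fin; _≟_)
open import Data.Product using (_×_; _,_; proj₁; proj₂; ∃)
open import Data.Sum using (_⊎_)
open import Data.Unit using (⊤)
open import Data.Empty using (⊥)
open import Data.List using (List; []; _∷_; map)
open import Data.List.Membership.Propositional using (_∈_)
open import Data.List.Relation.Unary.Any using (here; there)
open import Data.List.Relation.Unary.Unique.Propositional using (Unique)
open import Data.List.Relation.Unary.Linked using (Linked)
open import Relation.Nullary using (¬_; yes; no)
open import Relation.Binary.PropositionalEquality using (_≡_; refl; sym; trans)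

data ℕ∞ : Set where
  fin : ℕ → ℕ∞
  ∞   : ℕ∞

data _≤∞_ : ℕ∞ → ℕ∞ → Set where
  fin≤fin : ∀ {m n} → m ≤ n → fin m ≤∞ fin n
  _≤∞∞    : ∀ x → x ≤∞ ∞

_<∞_ : ℕ∞ → ℕ∞ → Set
x <∞ y = (x ≤∞ y) × ¬ (x ≡ y)

Matrix : ℕ → Set
Matrix n = Fin n → Fin n → ℕ∞

IsDistanceMatrix : ∀ {n} → Matrix n → Set
IsDistanceMatrix {n} D = ∀ (u v : Fin n) → (D u v ≡ fin 0 → u ≡ v) × (u ≡ v → D u v ≡ fin 0)

-- Temporal graphs on [n].
-- labels u v is the (finite) list of times at which the edge {u,v} is
-- present; the edge {u,v} carries the union of labels u v and labels v u
-- (so the representation is symmetric by construction).  An edge {u,v} is in G iff it has a label.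

record TemporalGraph (n : ℕ) : Set where
  field
    labels   : Fin n → Fin n → List ℕ
    loopless : ∀ u → labels u u ≡ []
    positive : ∀ u v τ → τ ∈ labels u v → 0 < τ
open TemporalGraph public

TEdge : ∀ {n} → TemporalGraph n → Fin n → Fin n → ℕ → Set
TEdge G x y τ = τ ∈ labels G x y ⊎ τ ∈ labels G y x

ValidHops : ∀ {n} → TemporalGraph n → Fin n → List (Fin n × ℕ) → Set
ValidHops G x []             = ⊤
ValidHops G x ((y , τ) ∷ hs) = TEdge G x y τ × ValidHops G y hs

endVertex : ∀ {n} → Fin n → List (Fin n × ℕ) → Fin n
endVertex x []             = x
endVertex x ((y , _) ∷ hs) = endVertex y hs

record StrictTemporalPath {n} (G : TemporalGraph n) (u v : Fin n) (a : ℕ) : Set where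
  field
    hops       : List (Fin n × ℕ)
    lastHop    : Fin n × ℕ
    valid      : ValidHops G u (hops Data.List.++ (lastHop ∷ []))
    ends       : proj₁ lastHop ≡ v
    arrival    : proj₂ lastHop ≡ a
    distinct   : Unique (u ∷ map proj₁ (hops Data.List.++ (lastHop ∷ [])))
    increasing : Linked _<_ (map proj₂ (hops Data.List.++ (lastHop ∷ [])))

data FoIs {n} (G : TemporalGraph n) (u v : Fin n) : ℕ∞ → Set where
  diag  : u ≡ v → FoIs G u v (fin 0)
  reach : ∀ {a} → ¬ (u ≡ v) → StrictTemporalPath G u v a
        → (∀ b → StrictTemporalPath G u v b → a ≤ b) → FoIs G u v (fin a)
  unreach : ¬ (u ≡ v) → (∀ b → ¬ StrictTemporalPath G u v b) → FoIs G u v ∞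

_≤Fo_at_,_ : ∀ {n} → Matrix n → TemporalGraph n → Fin n → Fin n → Set
D ≤Fo G at u , v = ∀ t → FoIs G u v t → D u v ≤∞ t

FoEdgeCompatible : ∀ {n} → Matrix n → Fin n → Fin n → ℕ → Set
FoEdgeCompatible {n} D v w τ =
  ∀ (x : Fin n) → (D x v <∞ fin τ → D x w ≤∞ fin τ)
                × (D x w <∞ fin τ → D x v ≤∞ fin τ)

FoCompatible : ∀ {n} → Matrix n → TemporalGraph n → Set
FoCompatible {n} D G =
  (∀ (u v : Fin n) → D ≤Fo G at u , v)
  × (∀ (v w : Fin n) (τ : ℕ) → TEdge G v w τ → FoEdgeCompatible D v w τ)

private
  addLbl : ∀ {n} → (Fin n → Fin n → List ℕ) → Fin n → Fin n → ℕ → Fin n → Fin n → List ℕ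
  addLbl L v w τ x y with x ≟ v | y ≟ w
  ... | yes _ | yes _ = τ ∷ L x y
  ... | _     | _     = L x y

  addLbl-loop : ∀ {n} (L : Fin n → Fin n → List ℕ) v w τ → ¬ (v ≡ w)
              → (∀ u → L u u ≡ []) → ∀ u → addLbl L v w τ u u ≡ []
  addLbl-loop L v w τ v≢w ll u with u ≟ v | u ≟ w
  ... | yes p | yes q = Data.Empty.⊥-elim (v≢w (trans (sym p) q))
  ... | yes _ | no _  = ll u
  ... | no _  | yes _ = ll u
  ... | no _  | no _  = ll u

  addLbl-pos : ∀ {n} (L : Fin n → Fin n → List ℕ) v w τ → 0 < τ
             → (∀ x y σ → σ ∈ L x y → 0 < σ) → ∀ x y σ → σ ∈ addLbl L v w τ x y → 0 < σ
  addLbl-pos L v w τ τ>0 ps x y σ m with x ≟ v | y ≟ w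
  addLbl-pos L v w τ τ>0 ps x y σ (here refl) | yes _ | yes _ = τ>0
  addLbl-pos L v w τ τ>0 ps x y σ (there m)   | yes _ | yes _ = ps x y σ m
  ... | yes _ | no _  = ps x y σ m
  ... | no _  | yes _ = ps x y σ m
  ... | no _  | no _  = ps x y σ m

addLabel : ∀ {n} → (G : TemporalGraph n) → (v w : Fin n) → ¬ (v ≡ w)
         → (τ : ℕ) → 0 < τ → TemporalGraph n
addLabel G v w v≢w τ τ>0 = record
  { labels   = addLbl (labels G) v w τ
  ; loopless = addLbl-loop (labels G) v w τ v≢w (loopless G)
  ; positive = addLbl-pos (labels G) v w τ τ>0 (positive G)
  }

{-# OPTIONS --safe #-}
-- Along a strict temporal path u = v₀, v₁, …, v_k with times τ₁ < … < τ_k we get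
-- D u vᵢ ≤ τᵢ for every i: D u v₀ = 0 < τ₁, and D u vᵢ ≤ τᵢ < τᵢ₊₁ together with
-- edge-compatibility of ({vᵢ,vᵢ₊₁}, τᵢ₊₁) gives D u vᵢ₊₁ ≤ τᵢ₊₁.  The temporal edges of the extended graph are those of
-- G together with ({v,w}, τ), all of them edge-compatible.
module Submission where

open import Defs
open import Data.Nat using (ℕ; _<_; z≤n)
open import Data.Nat.Properties using (<⇒≤; ≤-<-trans; <⇒≢)
open import Data.Fin using (Fin; _≟_)
open import Data.Product using (_×_; _,_; proj₁; proj₂)
open import Data.Sum using (_⊎_; inj₁; inj₂)
open import Data.List using ([]; _∷_; map; _++_; [_])
open import Data.List.Membership.Propositional using (_∈_)
open import Data.List.Relation.Unary.Any using (here; there)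
open import Data.List.Relation.Unary.Linked using (Linked; [-]; _∷_)
open import Relation.Nullary using (¬_; yes; no)
open import Relation.Binary.PropositionalEquality using (_≡_; refl)

≤∞-<-trans : ∀ {x t s} → x ≤∞ fin t → t < s → x <∞ fin s
≤∞-<-trans (fin≤fin m≤t) t<s =
  fin≤fin (<⇒≤ m<s) , λ { refl → <⇒≢ m<s refl }
  where m<s = ≤-<-trans m≤t t<s

IsDistanceMatrix-diag≤∞0 : ∀ {n} {D : Matrix n} → IsDistanceMatrix D → ∀ u → D u u ≤∞ fin 0
IsDistanceMatrix-diag≤∞0 isDist u rewrite proj₂ (isDist u u) refl = fin≤fin z≤n

EdgesFoCompatible : ∀ {n} → Matrix n → TemporalGraph n → Set
EdgesFoCompatible D G = ∀ v w τ → TEdge G v w τ → FoEdgeCompatible D v w τ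

FoEdgeCompatible-sym : ∀ {n} {D : Matrix n} {v w τ}
                     → FoEdgeCompatible D v w τ → FoEdgeCompatible D w v τ
FoEdgeCompatible-sym compatible x = proj₂ (compatible x) , proj₁ (compatible x)

TEdge-positive : ∀ {n} (G : TemporalGraph n) {x y σ} → TEdge G x y σ → 0 < σ
TEdge-positive G (inj₁ σ∈xy) = positive G _ _ _ σ∈xy
TEdge-positive G (inj₂ σ∈yx) = positive G _ _ _ σ∈yx

module _ {n} {D : Matrix n} {G : TemporalGraph n} (compatible : EdgesFoCompatible D G) where

  edgeCompatible-≤∞ : ∀ {u x y t s} → D u x ≤∞ fin t → t < s → TEdge G x y s
                    → D u y ≤∞ fin s
  edgeCompatible-≤∞ {u} Dux≤t t<s e = proj₁ (compatible _ _ _ e u) (≤∞-<-trans Dux≤t t<s)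

  ValidHops-≤∞ : ∀ {u x t} hs {y s} → D u x ≤∞ fin t
               → ValidHops G x (hs ++ [ (y , s) ])
               → Linked _<_ (t ∷ map proj₂ (hs ++ [ (y , s) ]))
               → D u y ≤∞ fin s
  ValidHops-≤∞ [] Dux≤t (e , _) (t<s ∷ _) = edgeCompatible-≤∞ Dux≤t t<s e
  ValidHops-≤∞ (_ ∷ hs) Dux≤t (e , valid) (t<r ∷ increasing) =
    ValidHops-≤∞ hs (edgeCompatible-≤∞ Dux≤t t<r e) valid increasing

  Linked-0∷ : ∀ {x} hs → ValidHops G x hs → Linked _<_ (map proj₂ hs)
            → Linked _<_ (0 ∷ map proj₂ hs)
  Linked-0∷ []      _       _          = [-]
  Linked-0∷ (_ ∷ _) (e , _) increasing = TEdge-positive G e ∷ increasing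

  StrictTemporalPath-≤∞ : ∀ {u z a} → D u u ≤∞ fin 0 → StrictTemporalPath G u z a
                        → D u z ≤∞ fin a
  StrictTemporalPath-≤∞ Duu≤0 record
    { hops = hs ; lastHop = _ ; valid = valid ; ends = refl ; arrival = refl
    ; increasing = increasing }
    = ValidHops-≤∞ hs Duu≤0 valid (Linked-0∷ (hs ++ [ _ ]) valid increasing)

  EdgesFoCompatible⇒≤Fo : IsDistanceMatrix D → ∀ u z → D ≤Fo G at u , z
  EdgesFoCompatible⇒≤Fo isDist u z _ (diag refl)      = IsDistanceMatrix-diag≤∞0 isDist u
  EdgesFoCompatible⇒≤Fo isDist u z _ (reach _ path _) =
    StrictTemporalPath-≤∞ (IsDistanceMatrix-diag≤∞0 isDist u) path
  EdgesFoCompatible⇒≤Fo isDist u z _ (unreach _ _)    = _ ≤∞∞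

module _ {n} (G : TemporalGraph n) {v w : Fin n} (v≢w : ¬ (v ≡ w)) {τ : ℕ} (τ>0 : 0 < τ) where

  ∈-addLabel : ∀ {x y σ} → σ ∈ labels (addLabel G v w v≢w τ τ>0) x y
             → (x ≡ v × y ≡ w × σ ≡ τ) ⊎ σ ∈ labels G x y
  ∈-addLabel {x} {y} σ∈ with x ≟ v | y ≟ w
  ∈-addLabel (here refl) | yes x≡v | yes y≡w = inj₁ (x≡v , y≡w , refl)
  ∈-addLabel (there σ∈) | yes _ | yes _ = inj₂ σ∈
  ... | yes _ | no _  = inj₂ σ∈
  ... | no _  | yes _ = inj₂ σ∈
  ... | no _  | no _  = inj₂ σ∈

  addLabel-EdgesFoCompatible : {D : Matrix n} → EdgesFoCompatible D G → FoEdgeCompatible D v w τ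
                             → EdgesFoCompatible D (addLabel G v w v≢w τ τ>0)
  addLabel-EdgesFoCompatible {D} compatible vw x y σ (inj₁ σ∈xy) with ∈-addLabel {x} {y} σ∈xy
  ... | inj₁ (refl , refl , refl) = vw
  ... | inj₂ σ∈ = compatible x y σ (inj₁ σ∈)
  addLabel-EdgesFoCompatible {D} compatible vw x y σ (inj₂ σ∈yx) with ∈-addLabel {y} {x} σ∈yx
  ... | inj₁ (refl , refl , refl) = FoEdgeCompatible-sym {D = D} vw
  ... | inj₂ σ∈ = compatible x y σ (inj₂ σ∈)

lemma3p7 : ∀ {n} (D : Matrix n) → IsDistanceMatrix D
         → (G : TemporalGraph n) → FoCompatible D G
         → (v w : Fin n) (v≢w : ¬ (v ≡ w)) (τ : ℕ) (τ>0 : 0 < τ)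
         → FoEdgeCompatible D v w τ
         → FoCompatible D (addLabel G v w v≢w τ τ>0)
lemma3p7 D isDist G (_ , compatible) v w v≢w τ τ>0 vw =
  EdgesFoCompatible⇒≤Fo compatible′ isDist , compatible′
  where
  compatible′ : EdgesFoCompatible D (addLabel G v w v≢w τ τ>0)
  compatible′ = addLabel-EdgesFoCompatible G v≢w τ>0 compatible vw
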